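{- Let $u$ be an infinite word over a finite alphabet which has property $R_m$ and which has no weak bispecial factor. Then $\Delta C(n)\ge m-1$ for all $n\ge 0$.
   Context: Let $u=u_0u_1\cdots$ be an infinite word over a finite alphabet $\mathcal A$. Factors are finite (possibly empty) words occurring in $u$; $\mathcal L_n(u)$ is the set of factors of length $n$, $C(n)=\#\mathcal L_n(u)$ is the complexity, and $\Delta C(n)=C(n+1)-C(n)$. For a factor $w$, $\mathcal E_\ell(w)=\{a\in\mathcal A: aw \text{ is a factor}\}$, $\mathcal E_r(w)=\{b\in\mathcal A: wb\text{ is a factor}\}$. If $j<k$ are successive occurrences of $w$ (positions $j$ with $u_j\cdots u_{j+|w|-1}=w$), then $u_j\cdots u_{k-1}$ is a return word of $w$; $\mathcal R(w)$ is the set of return words. Property $R_m$: every factor (including the empty word) has exactly $m$ return words. The bilateral order of a factor $w$ is $B(w)=\#\{awb \text{ factor of } u: a,b\in\mathcal A\}-\#\mathcal E_\ell(w)-\#\mathcal E_r(w)+1$, and $w$ is weak bispecial if $B(w)<0$ (this notion is used for recurrent words, i.e., words in which every factor occurs infinitely often). -}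

module Defs where

open import Data.Nat using (ℕ; zero; suc; _+_; _∸_; _<_)
open import Data.Fin using (Fin)
open import Data.List using (List; []; _∷_; length; _++_; [_])
open import Data.Product using (Σ; ∃; _×_; _,_)
open import Data.Integer as ℤ using (ℤ; +_; _-_; 0ℤ; 1ℤ)
open import Function.Definitions using (Injective)
open import Relation.Binary.PropositionalEquality using (_≡_)
open import Relation.Nullary using (¬_)

Word : ℕ → Set
Word k = ℕ → Fin k

slice : ∀ {k} → Word k → ℕ → ℕ → List (Fin k)
slice u i zero    = []
slice u i (suc n) = u i ∷ slice u (suc i) n

OccursAt : ∀ {k} → Word k → List (Fin k) → ℕ → Set
OccursAt u w j = slice u j (length w) ≡ w

Factor : ∀ {k} → Word k → List (Fin k) → Set
Factor u w = ∃ λ i → OccursAt u w i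

FactorOfLength : ∀ {k} → Word k → ℕ → List (Fin k) → Set
FactorOfLength u n w = length w ≡ n × Factor u w

ReturnWord : ∀ {k} → Word k → List (Fin k) → List (Fin k) → Set
ReturnWord u w r =
  Σ ℕ λ j → Σ ℕ λ l →
    j < l × OccursAt u w j × OccursAt u w l ×
    (∀ i → j < i → i < l → ¬ OccursAt u w i) ×
    slice u j (l ∸ j) ≡ r

record HasCard {X : Set} (P : X → Set) (n : ℕ) : Set where
  field
    enum     : Fin n → X
    enum-inj : Injective _≡_ _≡_ enum
    enum-in  : ∀ i → P (enum i)
    enum-all : ∀ x → P x → ∃ λ i → enum i ≡ x

-- Property R_m: every factor (including the empty word) has exactly m return words.
PropertyR : ∀ {k} → Word k → ℕ → Set
PropertyR u m = ∀ w → Factor u w → HasCard (ReturnWord u w) m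

LeftExt : ∀ {k} → Word k → List (Fin k) → Fin k → Set
LeftExt u w a = Factor u (a ∷ w)

RightExt : ∀ {k} → Word k → List (Fin k) → Fin k → Set
RightExt u w b = Factor u (w ++ [ b ])

BiExt : ∀ {k} → Word k → List (Fin k) → Fin k × Fin k → Set
BiExt u (w) (a , b) = Factor u (a ∷ w ++ [ b ])

-- B(w) = #bi-ext - #E_l - #E_r + 1, given the three cardinalities.
bilateralOrder : (p l r : ℕ) → ℤ
bilateralOrder p l r = + p - + l - + r ℤ.+ 1ℤ

WeakBispecial : ∀ {k} → Word k → List (Fin k) → Set
WeakBispecial u w =
  Σ ℕ λ p → Σ ℕ λ l → Σ ℕ λ r →
    HasCard (BiExt u w) p × HasCard (LeftExt u w) l × HasCard (RightExt u w) r ×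
    bilateralOrder p l r ℤ.< 0ℤ

-- ΔC(n) = C(n+1) - C(n), given C(n) = c and C(n+1) = c'.
deltaC : (c c' : ℕ) → ℤ
deltaC c c' = + c' - + c

-- Write C j for the number of factors of length j. A factor w that is not weak bispecial
-- satisfies #E_l(w) + #E_r(w) ≤ #{awb factor} + 1, and a non-factor has no extensions at all.
-- Summed over all words w of length j, the left extensions and the right extensions each
-- count the factors of length j + 1, and the bi-extensions those of length j + 2; hence
-- 2 C (j + 1) ≤ C (j + 2) + C j, i.e. ΔC is non-decreasing. Finally ΔC(0) = m - 1: C 0 = 1,
-- and the return words of the empty word are exactly the letters, so C 1 = m.
{-# OPTIONS --safe #-}
module Submission where

open import Defs
open import Data.Nat using (ℕ; suc)
open import Data.Integer using (+_; _-_; 1ℤ; _≤_)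
open import Data.List using (List)
open import Data.Fin using (Fin)
open import Relation.Nullary using (¬_)

open import Data.Empty using (⊥-elim)
open import Data.Fin.Base using (zero; suc; splitAt; join; _↑ˡ_; _↑ʳ_)
import Data.Fin.Properties as Fin
open import Data.Integer.Base as ℤ using (ℤ; 0ℤ)
import Data.Integer.Properties as ℤ
import Data.Integer.Solver as ℤ
open import Data.List.Base using ([]; _∷_; length; take; _++_; [_])
import Data.List.Properties as List
open import Data.Nat.Base as ℕ using (zero; _+_; _⊓_; z≤n; s≤s)
import Data.Nat.Properties as ℕ
open import Algebra.Properties.CommutativeMonoid.Sum ℕ.+-0-commutativeMonoid
  using (sum-syntax; ∑-comm; ∑-distrib-+; sum-cong-≗)
open import Data.Product.Base as Product using (∃; _×_; _,_; proj₁; proj₂; uncurry)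
open import Data.Product.Properties using (×-≡,≡→≡)
open import Data.Sum.Base as Sum using (_⊎_; inj₁; inj₂; [_,_])
open import Data.Sum.Properties using (inj₁-injective; inj₂-injective)
open import Data.Unit.Base using (⊤; tt)
open import Function.Base using (_∘_)
open import Function.Definitions using (Injective)
open import Relation.Binary.PropositionalEquality
  using (_≡_; refl; sym; trans; cong; cong₂; subst; module ≡-Reasoning)
open import Relation.Nullary.Decidable using (Dec; yes; no)
open import Relation.Unary using (Decidable; Empty; _≐_; _⟨⊎⟩_)

private
  variable
    X Y : Set
    P Q : X → Set
    k m n N j : ℕ

HasCard-≤ : HasCard P m → HasCard P n → m ℕ.≤ n
HasCard-≤ {m = m} {n = n} A B = Fin.injective⇒≤ index-injective
  where
  module A = HasCard A
  module B = HasCard B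
  index : Fin m → Fin n
  index i = proj₁ (B.enum-all (A.enum i) (A.enum-in i))
  index-injective : Injective _≡_ _≡_ index
  index-injective {i} {j} eq = A.enum-inj (begin
    A.enum i          ≡⟨ proj₂ (B.enum-all (A.enum i) (A.enum-in i)) ⟨
    B.enum (index i)  ≡⟨ cong B.enum eq ⟩
    B.enum (index j)  ≡⟨ proj₂ (B.enum-all (A.enum j) (A.enum-in j)) ⟩
    A.enum j          ∎)
    where open ≡-Reasoning

HasCard-unique : HasCard P m → HasCard P n → m ≡ n
HasCard-unique A B = ℕ.≤-antisym (HasCard-≤ A B) (HasCard-≤ B A)

HasCard-resp : P ≐ Q → HasCard P n → HasCard Q n
HasCard-resp (P⊆Q , Q⊆P) H = record
  { enum = enum ; enum-inj = enum-inj ; enum-in = P⊆Q ∘ enum-in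
  ; enum-all = λ x → enum-all x ∘ Q⊆P }
  where open HasCard H

HasCard-∅ : Empty P → HasCard P 0
HasCard-∅ empty = record
  { enum = λ () ; enum-inj = λ { {()} } ; enum-in = λ ()
  ; enum-all = λ x p → ⊥-elim (empty x p) }

HasCard-singleton : ∀ {x} → P x → (∀ {y} → P y → y ≡ x) → HasCard P 1
HasCard-singleton {x = x} p unique = record
  { enum = λ _ → x ; enum-inj = λ { {zero} {zero} _ → refl } ; enum-in = λ _ → p
  ; enum-all = λ y q → zero , sym (unique q) }

HasCard-⊎ : {P : X → Set} {Q : Y → Set} →
  HasCard P m → HasCard Q n → HasCard (P ⟨⊎⟩ Q) (m + n)
HasCard-⊎ {X = X} {Y = Y} {m = m} {n = n} {P = P} {Q = Q} A B = record
  { enum = enum ; enum-inj = enum-injective ; enum-in = enum-in ; enum-all = enum-all }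
  where
  module A = HasCard A
  module B = HasCard B
  enum : Fin (m + n) → X ⊎ Y
  enum = Sum.map A.enum B.enum ∘ splitAt m
  map-injective : Injective _≡_ _≡_ (Sum.map A.enum B.enum)
  map-injective {inj₁ i} {inj₁ j} eq = cong inj₁ (A.enum-inj (inj₁-injective eq))
  map-injective {inj₂ i} {inj₂ j} eq = cong inj₂ (B.enum-inj (inj₂-injective eq))
  map-injective {inj₁ _} {inj₂ _} ()
  map-injective {inj₂ _} {inj₁ _} ()
  enum-injective : Injective _≡_ _≡_ enum
  enum-injective {i} {j} eq = begin
    i                       ≡⟨ Fin.join-splitAt m n i ⟨
    join m n (splitAt m i)  ≡⟨ cong (join m n) (map-injective {splitAt m i} {splitAt m j} eq) ⟩
    join m n (splitAt m j)  ≡⟨ Fin.join-splitAt m n j ⟩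
    j                       ∎
    where open ≡-Reasoning
  enum-in : ∀ i → (P ⟨⊎⟩ Q) (enum i)
  enum-in i with splitAt m i
  ... | inj₁ i₁ = A.enum-in i₁
  ... | inj₂ i₂ = B.enum-in i₂
  enum-all : ∀ z → (P ⟨⊎⟩ Q) z → ∃ λ i → enum i ≡ z
  enum-all (inj₁ x) p with A.enum-all x p
  ... | i , refl = i ↑ˡ n , cong (Sum.map A.enum B.enum) (Fin.splitAt-↑ˡ m i n)
  enum-all (inj₂ y) q with B.enum-all y q
  ... | i , refl = m ↑ʳ i , cong (Sum.map A.enum B.enum) (Fin.splitAt-↑ʳ m n i)

HasCard-reindex : (ι : Y → X) → Injective _≡_ _≡_ ι →
  (∀ {x} → P x → ∃ λ y → ι y ≡ x) → HasCard (P ∘ ι) n → HasCard P n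
HasCard-reindex {P = P} ι ι-injective covers H = record
  { enum = ι ∘ enum ; enum-inj = enum-inj ∘ ι-injective ; enum-in = enum-in
  ; enum-all = enum-all′ }
  where
  open HasCard H
  enum-all′ : ∀ x → P x → ∃ λ i → ι (enum i) ≡ x
  enum-all′ x p with covers p
  ... | y , refl with enum-all y p
  ... | i , refl = i , refl

HasCard-Σ : {P : Fin k → Y → Set} {n : Fin k → ℕ} →
  (∀ a → HasCard (P a) (n a)) → HasCard (uncurry P) (∑[ a < k ] n a)
HasCard-Σ {k = zero} _ = HasCard-∅ λ { (() , _) }
HasCard-Σ {k = suc k} {Y = Y} {P = P} H =
  HasCard-reindex ι ι-injective covers
    (HasCard-resp fibres (HasCard-⊎ (H zero) (HasCard-Σ (H ∘ suc))))
  where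
  ι : Y ⊎ (Fin k × Y) → Fin (suc k) × Y
  ι = [ zero ,_ , Product.map₁ suc ]
  ι-injective : Injective _≡_ _≡_ ι
  ι-injective {inj₁ _} {inj₁ _} refl = refl
  ι-injective {inj₂ _} {inj₂ _} refl = refl
  covers : ∀ {z} → uncurry P z → ∃ λ y → ι y ≡ z
  covers {zero , y}  _ = inj₁ y , refl
  covers {suc a , y} _ = inj₂ (a , y) , refl
  fibres : (P zero ⟨⊎⟩ uncurry (P ∘ suc)) ≐ (uncurry P ∘ ι)
  fibres = (λ { {inj₁ _} p → p ; {inj₂ _} p → p })
         , (λ { {inj₁ _} p → p ; {inj₂ _} p → p })

indicator : {A : Set} → Dec A → ℕ
indicator (yes _) = 1
indicator (no _)  = 0

HasCard-Dec : {A : Set} (A? : Dec A) → HasCard (λ (_ : ⊤) → A) (indicator A?)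
HasCard-Dec (yes a) = HasCard-singleton a (λ _ → refl)
HasCard-Dec (no ¬a) = HasCard-∅ (λ _ → ¬a)

HasCard-Fin : {P : Fin k → Set} (P? : Decidable P) → HasCard P (∑[ a < k ] indicator (P? a))
HasCard-Fin {P = P} P? =
  HasCard-reindex proj₁ (λ a≡b → ×-≡,≡→≡ (a≡b , refl)) (λ {a} _ → (a , tt) , refl)
    (HasCard-Σ {P = λ a _ → P a} (λ a → HasCard-Dec (P? a)))

∑-mono : {f g : Fin n → ℕ} →
  (∀ a → f a ℕ.≤ g a) → ∑[ a < n ] f a ℕ.≤ ∑[ a < n ] g a
∑-mono {n = zero}  _   = z≤n
∑-mono {n = suc n} f≤g = ℕ.+-mono-≤ (f≤g zero) (∑-mono (f≤g ∘ suc))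

sumWords : ℕ → (List (Fin k) → ℕ) → ℕ
sumWords         zero    f = f []
sumWords {k = k} (suc j) f = ∑[ a < k ] sumWords j (λ w → f (a ∷ w))

-- For f the indicator of the factors of u, these are #E_l(w), #E_r(w) and #{awb factor}.
∑ˡ ∑ʳ ∑ˡʳ : (List (Fin k) → ℕ) → List (Fin k) → ℕ
∑ˡ  {k = k} f w = ∑[ a < k ] f (a ∷ w)
∑ʳ  {k = k} f w = ∑[ b < k ] f (w ++ [ b ])
∑ˡʳ {k = k} f w = ∑[ a < k ] ∑[ b < k ] f (a ∷ w ++ [ b ])

sumWords-∑ : ∀ j (g : Fin k → List (Fin k) → ℕ) →
  sumWords j (λ w → ∑[ a < k ] g a w) ≡ ∑[ a < k ] sumWords j (g a)
sumWords-∑         zero    g = refl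
sumWords-∑ {k = k} (suc j) g = begin
  ∑[ b < k ] sumWords j (λ w → ∑[ a < k ] g a (b ∷ w))
    ≡⟨ sum-cong-≗ (λ b → sumWords-∑ j (λ a w → g a (b ∷ w))) ⟩
  ∑[ b < k ] ∑[ a < k ] sumWords j (λ w → g a (b ∷ w))
    ≡⟨ ∑-comm (λ b a → sumWords j (λ w → g a (b ∷ w))) ⟩
  ∑[ a < k ] ∑[ b < k ] sumWords j (λ w → g a (b ∷ w))
    ∎
  where open ≡-Reasoning

sumWords-∑ˡ : ∀ j (f : List (Fin k) → ℕ) → sumWords j (∑ˡ f) ≡ sumWords (suc j) f
sumWords-∑ˡ j f = sumWords-∑ j (λ a w → f (a ∷ w))

sumWords-∑ʳ : ∀ j (f : List (Fin k) → ℕ) → sumWords j (∑ʳ f) ≡ sumWords (suc j) f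
sumWords-∑ʳ zero    f = refl
sumWords-∑ʳ (suc j) f = sum-cong-≗ (λ a → sumWords-∑ʳ j (λ w → f (a ∷ w)))

sumWords-∑ˡʳ : ∀ j (f : List (Fin k) → ℕ) →
  sumWords j (∑ˡʳ f) ≡ sumWords (suc (suc j)) f
sumWords-∑ˡʳ j f = trans (sumWords-∑ˡ j (∑ʳ f)) (sumWords-∑ʳ (suc j) f)

sumWords-+ : ∀ j (f g : List (Fin k) → ℕ) →
  sumWords j (λ w → f w + g w) ≡ sumWords j f + sumWords j g
sumWords-+ zero    f g = refl
sumWords-+ (suc j) f g = trans
  (sum-cong-≗ (λ a → sumWords-+ j (f ∘ (a ∷_)) (g ∘ (a ∷_))))
  (∑-distrib-+ (λ a → sumWords j (f ∘ (a ∷_))) (λ a → sumWords j (g ∘ (a ∷_))))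

sumWords-mono : {f g : List (Fin k) → ℕ} →
  (∀ w → length w ≡ j → f w ℕ.≤ g w) → sumWords j f ℕ.≤ sumWords j g
sumWords-mono {j = zero}  f≤g = f≤g [] refl
sumWords-mono {j = suc j} f≤g =
  ∑-mono (λ a → sumWords-mono (λ w len → f≤g (a ∷ w) (cong suc len)))

sumWords-convex : ∀ j (f : List (Fin k) → ℕ) →
  (∀ w → length w ≡ j → ∑ˡ f w + ∑ʳ f w ℕ.≤ ∑ˡʳ f w + f w) →
  sumWords (suc j) f + sumWords (suc j) f ℕ.≤ sumWords (suc (suc j)) f + sumWords j f
sumWords-convex j f local = begin
  sumWords (suc j) f + sumWords (suc j) f  ≡⟨ cong₂ _+_ (sumWords-∑ˡ j f) (sumWords-∑ʳ j f) ⟨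
  sumWords j (∑ˡ f) + sumWords j (∑ʳ f)    ≡⟨ sumWords-+ j (∑ˡ f) (∑ʳ f) ⟨
  sumWords j (λ w → ∑ˡ f w + ∑ʳ f w)       ≤⟨ sumWords-mono local ⟩
  sumWords j (λ w → ∑ˡʳ f w + f w)         ≡⟨ sumWords-+ j (∑ˡʳ f) f ⟩
  sumWords j (∑ˡʳ f) + sumWords j f        ≡⟨ cong (_+ sumWords j f) (sumWords-∑ˡʳ j f) ⟩
  sumWords (suc (suc j)) f + sumWords j f  ∎
  where open ℕ.≤-Reasoning

HasCard-words : {P : List (Fin k) → Set} (P? : Decidable P) →
  ∀ j → HasCard (λ w → length w ≡ j × P w) (sumWords j (indicator ∘ P?))
HasCard-words {P = P} P? zero = empty-word (P? [])
  where
  empty-word : (d : Dec (P [])) → HasCard (λ w → length w ≡ 0 × P w) (indicator d)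
  empty-word (yes p) = HasCard-singleton (refl , p) λ { {[]} _ → refl ; {_ ∷ _} (() , _) }
  empty-word (no ¬p) = HasCard-∅ λ { [] (_ , p) → ¬p p ; (_ ∷ _) (() , _) }
HasCard-words {P = P} P? (suc j) =
  HasCard-reindex (uncurry _∷_) (×-≡,≡→≡ ∘ List.∷-injective) covers
    (HasCard-resp (Product.map₁ (cong suc) , Product.map₁ ℕ.suc-injective)
      (HasCard-Σ (λ a → HasCard-words {P = P ∘ (a ∷_)} (P? ∘ (a ∷_)) j)))
  where
  covers : ∀ {v} → length v ≡ suc j × P v → ∃ λ (aw : _ × _) → uncurry _∷_ aw ≡ v
  covers {a ∷ w} _ = (a , w) , refl

take-length-++ : (xs ys : List X) → take (length xs) (xs ++ ys) ≡ xs
take-length-++ []       ys = refl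
take-length-++ (x ∷ xs) ys = cong (x ∷_) (take-length-++ xs ys)

length-∷ʳ : (xs : List X) (y : X) → length (xs ++ [ y ]) ≡ suc (length xs)
length-∷ʳ []       y = refl
length-∷ʳ (x ∷ xs) y = cong suc (length-∷ʳ xs y)

module _ {k : ℕ} (u : Word k) where

  length-slice : ∀ i n → length (slice u i n) ≡ n
  length-slice i zero    = refl
  length-slice i (suc n) = cong suc (length-slice (suc i) n)

  take-slice : ∀ i j n → take j (slice u i n) ≡ slice u i (j ⊓ n)
  take-slice i zero    n       = refl
  take-slice i (suc j) zero    = refl
  take-slice i (suc j) (suc n) = cong (u i ∷_) (take-slice (suc i) j n)

  factor-take : ∀ j {v} → Factor u v → Factor u (take j v)
  factor-take j {v} (i , occ) = i , (begin
    slice u i (length (take j v))  ≡⟨ cong (slice u i) (List.length-take j v) ⟩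
    slice u i (j ⊓ length v)       ≡⟨ take-slice i j (length v) ⟨
    take j (slice u i (length v))  ≡⟨ cong (take j) occ ⟩
    take j v                       ∎)
    where open ≡-Reasoning

  factor-tail : ∀ {a w} → Factor u (a ∷ w) → Factor u w
  factor-tail (i , occ) = suc i , List.∷-injectiveʳ occ

  factor-init : ∀ {w b} → Factor u (w ++ [ b ]) → Factor u w
  factor-init {w} {b} f = subst (Factor u) (take-length-++ w [ b ]) (factor-take (length w) f)

  factorsOfLength-zero : HasCard (FactorOfLength u 0) 1
  factorsOfLength-zero =
    HasCard-singleton (refl , 0 , refl) λ { {[]} _ → refl ; {_ ∷ _} (() , _) }

  -- Every position is an occurrence of the empty word, so successive occurrences are j, j + 1.
  returnWord-ε : ReturnWord u [] ≐ FactorOfLength u 1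
  returnWord-ε = returnWord⇒letter , letter⇒returnWord
    where
    returnWord⇒letter : ∀ {r} → ReturnWord u [] r → FactorOfLength u 1 r
    returnWord⇒letter (j , l , j<l , _ , _ , none-between , refl) with ℕ.m≤n⇒m<n∨m≡n j<l
    ... | inj₁ 1+j<l = ⊥-elim (none-between (suc j) (ℕ.n<1+n j) 1+j<l refl)
    ... | inj₂ refl  =
      subst (λ n → FactorOfLength u 1 (slice u j n)) (sym (ℕ.m+n∸n≡m 1 j)) (refl , j , refl)
    letter⇒returnWord : ∀ {r} → FactorOfLength u 1 r → ReturnWord u [] r
    letter⇒returnWord {r} (len , i , occ) =
      i , suc i , ℕ.n<1+n i , refl , refl ,
      (λ _ i<i′ i′<1+i _ → ℕ.<⇒≱ i<i′ (ℕ.≤-pred i′<1+i)) ,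
      trans (cong (slice u i) (trans (ℕ.m+n∸n≡m 1 i) (sym len))) occ

m+q≤o+n⇒m-n≤o-q : ∀ m n o q → m + q ℕ.≤ o + n → + m - + n ≤ + o - + q
m+q≤o+n⇒m-n≤o-q m n o q le =
  ℤ.0≤i-j⇒j≤i (subst (0ℤ ≤_) (sym difference) (ℤ.i≤j⇒0≤j-i (ℤ.+≤+ le)))
  where
  open ℤ.+-*-Solver
  difference : (+ o - + q) - (+ m - + n) ≡ + (o + n) - + (m + q)
  difference rewrite ℤ.pos-+ o n | ℤ.pos-+ m q =
    solve 4 (λ m n o q → (o :- q) :- (m :- n) := (o :+ n) :- (m :+ q)) refl (+ m) (+ n) (+ o) (+ q)

0≤bilateralOrder⇒l+r≤p+1 : ∀ p l r → 0ℤ ≤ bilateralOrder p l r → l + r ℕ.≤ p + 1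
0≤bilateralOrder⇒l+r≤p+1 p l r nonneg =
  ℤ.drop‿+≤+ (ℤ.0≤i-j⇒j≤i (subst (0ℤ ≤_) difference nonneg))
  where
  open ℤ.+-*-Solver
  difference : bilateralOrder p l r ≡ + (p + 1) - + (l + r)
  difference rewrite ℤ.pos-+ p 1 | ℤ.pos-+ l r =
    solve 3 (λ p l r → p :- l :- r :+ con 1ℤ := p :+ con 1ℤ :- (l :+ r)) refl (+ p) (+ l) (+ r)

Δ : (ℕ → ℕ) → ℕ → ℤ
Δ C j = deltaC (C j) (C (suc j))

Δ-mono : (C : ℕ → ℕ) →
  (∀ j → suc (suc j) ℕ.≤ N → C (suc j) + C (suc j) ℕ.≤ C (suc (suc j)) + C j) →
  ∀ n → suc n ℕ.≤ N → Δ C 0 ≤ Δ C n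
Δ-mono C convex zero    _     = ℤ.≤-refl
Δ-mono C convex (suc n) short = ℤ.≤-trans (Δ-mono C convex n (ℕ.<⇒≤ short))
  (m+q≤o+n⇒m-n≤o-q (C (suc n)) (C n) (C (suc (suc n))) (C (suc n)) (convex n short))

module FactorCounts {k : ℕ} (u : Word k) {N c : ℕ}
  (factors-N : HasCard (FactorOfLength u N) c) where

  open HasCard factors-N

  -- Being a factor is not decidable for an infinite word, but up to length N it is
  -- decided by the given enumeration of the factors of length N.
  PrefixOfFactor : List (Fin k) → Set
  PrefixOfFactor w = ∃ λ t → take (length w) (enum t) ≡ w

  prefixOfFactor? : Decidable PrefixOfFactor
  prefixOfFactor? w = Fin.any? (λ t → List.≡-dec Fin._≟_ (take (length w) (enum t)) w)

  prefix⇒factor : ∀ {w} → PrefixOfFactor w → Factor u w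
  prefix⇒factor {w} (t , prefix) =
    subst (Factor u) prefix (factor-take u (length w) (proj₂ (enum-in t)))

  factor⇒prefix : ∀ {w} → length w ℕ.≤ N → Factor u w → PrefixOfFactor w
  factor⇒prefix {w} short (i , occ)
    with enum-all (slice u i N) (length-slice u i N , i , cong (slice u i) (length-slice u i N))
  ... | t , enum-t = t , (begin
    take (length w) (enum t)       ≡⟨ cong (take (length w)) enum-t ⟩
    take (length w) (slice u i N)  ≡⟨ take-slice u i (length w) N ⟩
    slice u i (length w ⊓ N)       ≡⟨ cong (slice u i) (ℕ.m≤n⇒m⊓n≡m short) ⟩
    slice u i (length w)           ≡⟨ occ ⟩
    w                              ∎)
    where open ≡-Reasoning

  prefix≐factor : (ι : X → List (Fin k)) → (∀ x → length (ι x) ℕ.≤ N) →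
    PrefixOfFactor ∘ ι ≐ Factor u ∘ ι
  prefix≐factor ι short = prefix⇒factor , factor⇒prefix (short _)

  χ : List (Fin k) → ℕ
  χ = indicator ∘ prefixOfFactor?

  C : ℕ → ℕ
  C j = sumWords j χ

  HasCard-C : j ℕ.≤ N → HasCard (FactorOfLength u j) (C j)
  HasCard-C {j} j≤N = HasCard-resp
    (Product.map₂ prefix⇒factor , λ { (refl , f) → refl , factor⇒prefix j≤N f })
    (HasCard-words prefixOfFactor? j)

  HasCard-LeftExt : ∀ {w} → length w ℕ.< N → HasCard (LeftExt u w) (∑ˡ χ w)
  HasCard-LeftExt {w} short = HasCard-resp
    (prefix≐factor (_∷ w) (λ _ → short))
    (HasCard-Fin (prefixOfFactor? ∘ (_∷ w)))

  HasCard-RightExt : ∀ {w} → length w ℕ.< N → HasCard (RightExt u w) (∑ʳ χ w)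
  HasCard-RightExt {w} short = HasCard-resp
    (prefix≐factor (λ b → w ++ [ b ]) (λ b → subst (ℕ._≤ N) (sym (length-∷ʳ w b)) short))
    (HasCard-Fin (λ b → prefixOfFactor? (w ++ [ b ])))

  HasCard-BiExt : ∀ {w} → suc (length w) ℕ.< N → HasCard (BiExt u w) (∑ˡʳ χ w)
  HasCard-BiExt {w} short = HasCard-resp
    (prefix≐factor (λ (a , b) → a ∷ w ++ [ b ])
      (λ (a , b) → subst (ℕ._≤ N) (sym (cong suc (length-∷ʳ w b))) short))
    (HasCard-Σ (λ a → HasCard-Fin (λ b → prefixOfFactor? (a ∷ w ++ [ b ]))))

  module _ (no-weak-bispecial : ∀ w → Factor u w → ¬ WeakBispecial u w) where

    extensions-bound : ∀ {w} → suc (suc (length w)) ℕ.≤ N →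
      ∑ˡ χ w + ∑ʳ χ w ℕ.≤ ∑ˡʳ χ w + χ w
    extensions-bound {w} short = bound (prefixOfFactor? w)
      where
      short′ : length w ℕ.< N
      short′ = ℕ.<⇒≤ short
      weakBispecial : bilateralOrder (∑ˡʳ χ w) (∑ˡ χ w) (∑ʳ χ w) ℤ.< 0ℤ → WeakBispecial u w
      weakBispecial negative = _ , _ , _ ,
        HasCard-BiExt short , HasCard-LeftExt short′ , HasCard-RightExt short′ , negative
      bound : (d : Dec (PrefixOfFactor w)) → ∑ˡ χ w + ∑ʳ χ w ℕ.≤ ∑ˡʳ χ w + indicator d
      bound (yes p) = 0≤bilateralOrder⇒l+r≤p+1 (∑ˡʳ χ w) (∑ˡ χ w) (∑ʳ χ w)
        (ℤ.≮⇒≥ (no-weak-bispecial w (prefix⇒factor p) ∘ weakBispecial))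
      bound (no ¬p) = ℕ.≤-trans (ℕ.≤-reflexive (cong₂ _+_ no-left no-right)) z≤n
        where
        ¬w : ¬ Factor u w
        ¬w = ¬p ∘ factor⇒prefix (ℕ.<⇒≤ short′)
        no-left : ∑ˡ χ w ≡ 0
        no-left = HasCard-unique (HasCard-LeftExt short′)
          (HasCard-∅ (λ _ → ¬w ∘ factor-tail u))
        no-right : ∑ʳ χ w ≡ 0
        no-right = HasCard-unique (HasCard-RightExt short′)
          (HasCard-∅ (λ _ → ¬w ∘ factor-init u))

    C-convex : ∀ j → suc (suc j) ℕ.≤ N → C (suc j) + C (suc j) ℕ.≤ C (suc (suc j)) + C j
    C-convex j short = sumWords-convex j χ
      (λ w len → extensions-bound (subst (λ l → suc (suc l) ℕ.≤ N) (sym len) short))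

lemma4p2 : ∀ {k} (u : Word k) (m : ℕ) → PropertyR u m →
    (∀ (w : List (Fin k)) → Factor u w → ¬ WeakBispecial u w) →
    ∀ (n c c' : ℕ) → HasCard (FactorOfLength u n) c → HasCard (FactorOfLength u (suc n)) c' →
    + m - 1ℤ ≤ deltaC c c'
lemma4p2 u m R no-weak-bispecial n c c' factors-n factors-suc-n = begin
  + m - 1ℤ     ≡⟨ cong₂ deltaC C0≡1 C1≡m ⟨
  Δ C 0        ≤⟨ Δ-mono C (C-convex no-weak-bispecial) n ℕ.≤-refl ⟩
  Δ C n        ≡⟨ cong₂ deltaC Cn≡c Csn≡c' ⟩
  deltaC c c'  ∎
  where
  open FactorCounts u factors-suc-n
  open ℤ.≤-Reasoning
  C0≡1 : C 0 ≡ 1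
  C0≡1 = HasCard-unique (HasCard-C z≤n) (factorsOfLength-zero u)
  C1≡m : C 1 ≡ m
  C1≡m = HasCard-unique (HasCard-C (s≤s z≤n))
    (HasCard-resp (returnWord-ε u) (R [] (0 , refl)))
  Cn≡c : C n ≡ c
  Cn≡c = HasCard-unique (HasCard-C (ℕ.n≤1+n n)) factors-n
  Csn≡c' : C (suc n) ≡ c'
  Csn≡c' = HasCard-unique (HasCard-C ℕ.≤-refl) factors-suc-n
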